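{- Let $f,g$ be two covers with $f\sqsubseteq g$. If $g$ is Galois, then every cover $h\in{\rm Hom}(g,f)$ is Galois.
   Context: Let $\mathbf C$ be a category and $\mathbf D$ a full subcategory of $\mathbf C$. For arrows $f,g$ of $\mathbf C$ with ${\rm cod}\,f={\rm cod}\,g$, ${\rm Hom}(g,f)$ denotes the collection of all arrows $h$ of $\mathbf C$ with $g=f\circ h$. Standing assumptions: (G1) every diagram $B\to A\leftarrow C$ in $\mathbf D$ has a pullback in $\mathbf C$. (G2) (I) pushouts exist in $\mathbf D$; (II) every arrow of $\mathbf D$ is epic; (III) every monic arrow of $\mathbf D$ is an isomorphism whose inverse is an arrow of $\mathbf D$. (G3) for every object $U$ of $\mathbf C$ there is a set $\Sigma(U)$ of arrows $i$ of $\mathbf C$ with ${\rm dom}\,i$ in $\mathbf D$ and ${\rm cod}\,i=U$ such that for every arrow $u$ of $\mathbf C$ with ${\rm dom}\,u$ in $\mathbf D$ and ${\rm cod}\,u=U$ there is exactly one $i\in\Sigma(U)$ with ${\rm Hom}(u,i)\neq\emptyset$. (G4) there is a function $\deg$ from the collection of arrows of $\mathbf C$ whose codomain lies in $\mathbf D$ to the positive integers such that (I) $\deg(g\circ f)=\deg g\cdot\deg f$ whenever $f,g,g\circ f$ all lie in this collection; (II) $\deg f=\sum_{i\in\Sigma({\rm dom}\,f)}\deg(f\circ i)$ for every such $f$; (III) if $B\xrightarrow{f}A\xleftarrow{g}C$ is a diagram in $\mathbf D$ with pullback $B\xleftarrow{p}U\xrightarrow{q}C$, then $\deg f=\deg q$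 and $\deg g=\deg p$. A cover is an arrow of $\mathbf D$. For a cover $f$, ${\rm Aut}(f)$ is the set of isomorphisms in ${\rm Hom}(f,f)$; $f$ is Galois if $|{\rm Aut}(f)|=\deg f$. Write $f\sqsubseteq g$ if ${\rm cod}\,f={\rm cod}\,g$ and ${\rm Hom}(g,f)\neq\emptyset$. -}

module Defs where

open import Level using (Level; _⊔_; suc)
open import Data.Nat using (ℕ; zero; _+_; _*_; _>_)
import Data.Nat as N
open import Data.Fin using (Fin)
import Data.Fin as F
open import Data.Product using (Σ; ∃; ∃-syntax; _×_; _,_)
open import Relation.Binary.PropositionalEquality using (_≡_)

sumFin : (n : ℕ) → (Fin n → ℕ) → ℕ
sumFin zero    a = 0
sumFin (N.suc n) a = a F.zero + sumFin n (λ k → a (F.suc k))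

record Category (o ℓ : Level) : Set (suc (o ⊔ ℓ)) where
  infixr 9 _∘_
  field
    Obj  : Set o
    Hom  : Obj → Obj → Set ℓ
    id   : ∀ {A} → Hom A A
    _∘_  : ∀ {A B C} → Hom B C → Hom A B → Hom A C
    assoc : ∀ {A B C D} (h : Hom C D) (g : Hom B C) (f : Hom A B) →
            (h ∘ g) ∘ f ≡ h ∘ (g ∘ f)
    identityˡ : ∀ {A B} (f : Hom A B) → id ∘ f ≡ f
    identityʳ : ∀ {A B} (f : Hom A B) → f ∘ id ≡ f

module CatDefs {o ℓ : Level} (C : Category o ℓ) where
  open Category C

  -- Hom(g,f) for f : A → X, g : B → X : arrows h with g = f ∘ h
  HomOver : ∀ {A B X} → Hom B X → Hom A X → Set ℓ
  HomOver {A} {B} g f = Σ (Hom B A) (λ h → g ≡ f ∘ h)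

  _⊑_ : ∀ {A B X} → Hom A X → Hom B X → Set ℓ
  f ⊑ g = HomOver g f

  IsIso : ∀ {A B} → Hom A B → Set ℓ
  IsIso {A} {B} f = Σ (Hom B A) (λ g → (g ∘ f ≡ id) × (f ∘ g ≡ id))

  IsPullback : ∀ {A B C' U} (f : Hom B A) (g : Hom C' A)
               (p : Hom U B) (q : Hom U C') → Set (o ⊔ ℓ)
  IsPullback {A} {B} {C'} {U} f g p q =
    (f ∘ p ≡ g ∘ q) ×
    (∀ {W} (p' : Hom W B) (q' : Hom W C') → f ∘ p' ≡ g ∘ q' →
       Σ (Hom W U) (λ u → (p ∘ u ≡ p') × (q ∘ u ≡ q')) ×
       (∀ (u v : Hom W U) → p ∘ u ≡ p' → q ∘ u ≡ q' →
                            p ∘ v ≡ p' → q ∘ v ≡ q' → u ≡ v))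

-- The standing assumptions (G1)-(G4) on a category C with a full
-- subcategory D (given by the predicate inD on objects).
record Setting (o ℓ : Level) : Set (suc (o ⊔ ℓ)) where
  field
    cat : Category o ℓ
  open Category cat public
  open CatDefs cat public
  field
    inD : Obj → Set ℓ
    G1 : ∀ {A B C'} → inD A → inD B → inD C' →
         (f : Hom B A) (g : Hom C' A) →
         Σ Obj (λ U → Σ (Hom U B) (λ p → Σ (Hom U C') (λ q → IsPullback f g p q)))
    G2-I : ∀ {A B C'} → inD A → inD B → inD C' →
           (f : Hom A B) (g : Hom A C') →
           Σ Obj (λ P → inD P × Σ (Hom B P) (λ i₁ → Σ (Hom C' P) (λ i₂ →
             (i₁ ∘ f ≡ i₂ ∘ g) ×
             (∀ {W} → inD W → (j₁ : Hom B W) (j₂ : Hom C' W) → j₁ ∘ f ≡ j₂ ∘ g →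
                Σ (Hom P W) (λ u → (u ∘ i₁ ≡ j₁) × (u ∘ i₂ ≡ j₂)) ×
                (∀ (u v : Hom P W) → u ∘ i₁ ≡ j₁ → u ∘ i₂ ≡ j₂ →
                                     v ∘ i₁ ≡ j₁ → v ∘ i₂ ≡ j₂ → u ≡ v)))))
    G2-II : ∀ {A B} → inD A → inD B → (f : Hom A B) →
            ∀ {W} → inD W → (u v : Hom B W) → u ∘ f ≡ v ∘ f → u ≡ v
    -- (G2)(III) every monic arrow of D is an isomorphism (inverse lies in D by fullness)
    G2-III : ∀ {A B} → inD A → inD B → (f : Hom A B) →
             (∀ {W} → inD W → (u v : Hom W A) → f ∘ u ≡ f ∘ v → u ≡ v) →
             IsIso f
    -- (G3) the sets Σ(U), indexed by a type Ix U (without repetition, by uniqueness)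
    Ix   : Obj → Set ℓ
    idom : ∀ {U} → Ix U → Obj
    idomD : ∀ {U} (k : Ix U) → inD (idom k)
    ι    : ∀ {U} (k : Ix U) → Hom (idom k) U
    G3-ex  : ∀ {U X} → inD X → (u : Hom X U) → Σ (Ix U) (λ k → HomOver u (ι k))
    G3-uniq : ∀ {U X} → inD X → (u : Hom X U) → (k k' : Ix U) →
              HomOver u (ι k) → HomOver u (ι k') → k ≡ k'
    -- (G4) degree on arrows; only its values on arrows with codomain in D matter
    deg : ∀ {A B} → Hom A B → ℕ
    deg-pos : ∀ {A B} → inD B → (f : Hom A B) → deg f > 0
    G4-I : ∀ {X Y Z} → inD Y → inD Z → (f : Hom X Y) (g : Hom Y Z) →
           deg (g ∘ f) ≡ deg g * deg f
    -- (G4)(II): Σ(dom f) is finite (enumerated bijectively by Fin n) and the sum holds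
    G4-II : ∀ {U B} → inD B → (f : Hom U B) →
            Σ ℕ (λ n → Σ (Fin n → Ix U) (λ e →
              (∀ i j → e i ≡ e j → i ≡ j) × (∀ k → ∃[ i ] e i ≡ k) ×
              (deg f ≡ sumFin n (λ i → deg (f ∘ ι (e i))))))
    G4-III : ∀ {A B C' U} → inD A → inD B → inD C' →
             (f : Hom B A) (g : Hom C' A) (p : Hom U B) (q : Hom U C') →
             IsPullback f g p q → (deg f ≡ deg q) × (deg g ≡ deg p)

module SettingDefs {o ℓ : Level} (S : Setting o ℓ) where
  open Setting S

  -- a cover is an arrow of D
  IsCover : ∀ {A B} → Hom A B → Set ℓ
  IsCover {A} {B} f = inD A × inD B

  IsAut : ∀ {A B} → Hom A B → Hom A A → Set ℓ
  IsAut f h = (f ≡ f ∘ h) × IsIso h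

  AutCard : ∀ {A B} → Hom A B → ℕ → Set ℓ
  AutCard {A} f n = Σ (Fin n → Hom A A) (λ e →
      (∀ i → IsAut f (e i)) ×
      (∀ i j → e i ≡ e j → i ≡ j) ×
      (∀ h → IsAut f h → ∃[ i ] e i ≡ h))

  IsGalois : ∀ {A B} → Hom A B → Set ℓ
  IsGalois f = AutCard f (deg f)

Cor3p15 : ∀ {o ℓ : Level} → Setting o ℓ → Set (o ⊔ ℓ)
Cor3p15 S =
    ∀ {A B X : Obj} (f : Hom A X) (g : Hom B X) →
    IsCover f → IsCover g → f ⊑ g → IsGalois g →
    (h : Hom B A) → g ≡ f ∘ h → IsCover h → IsGalois h
  where open Setting S
        open SettingDefs S

{-# OPTIONS --safe #-}

-- Write g = f ∘ h.  Every automorphism of h is one of g, and for each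
-- automorphism σ of g the arrow h ∘ σ lies in Hom(g, f).  Since |Hom(u, f)| ≤ deg f
-- for covers, the fibres of σ ↦ h ∘ σ are cosets of Aut(h) and |Aut(h)| ≤ deg h,
-- we get  deg f · deg h = deg g = |Aut(g)| ≤ deg f · |Aut(h)| ≤ deg f · deg h.
module Submission where

open import Level using (Level; _⊔_)
open import Defs
open import Axiom.UniquenessOfIdentityProofs.WithK using (uip)
open import Data.Nat using (ℕ; zero; suc; _≤_; _<_; _*_; z≤n; >-nonZero)
open import Data.Nat.Properties using (≤-trans; ≤-reflexive; ≤-antisym; *-cancelˡ-≤; +-mono-≤)
open import Data.Fin using (Fin; zero; suc; combine; _≟_)
open import Data.Fin.Properties using (any?; injective⇒≤; combine-injective; inject≤-injective; suc-injective)
open import Data.Product using (Σ; ∃-syntax; _×_; _,_; proj₁; proj₂; map; map₂)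
open import Function using (_∘′_; _↣_; Injection; mk↣; Injective)
open import Function.Construct.Composition using (_↣-∘_)
open import Relation.Nullary using (Dec; yes; no; Irrelevant; contradiction)
open import Relation.Nullary.Decidable using (map′)
open import Relation.Unary using (Pred; Decidable)
open import Relation.Binary.PropositionalEquality

open Injection using (to; injective)

private
  variable
    a b p q : Level
    m n N : ℕ

proj₁-injective : {A : Set a} {B : A → Set b} → (∀ {x} → Irrelevant (B x)) →
                  {u v : Σ A B} → proj₁ u ≡ proj₁ v → u ≡ v
proj₁-injective irr {x , u} {.x , v} refl = cong (x ,_) (irr u v)

↣⇒≤ : Fin m ↣ Fin n → m ≤ n
↣⇒≤ φ = injective⇒≤ (injective φ)

↣-inject≤ : m ≤ n → Fin m ↣ Fin n
↣-inject≤ m≤n = mk↣ (λ {i} {j} → inject≤-injective m≤n m≤n i j)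

n≤sumFin : ∀ n (w : Fin n → ℕ) → (∀ i → 0 < w i) → n ≤ sumFin n w
n≤sumFin zero    w w>0 = z≤n
n≤sumFin (suc n) w w>0 = +-mono-≤ (w>0 zero) (n≤sumFin n (w ∘′ suc) (λ i → w>0 (suc i)))

Enumeration : {A : Set a} → Pred A p → ℕ → Set (a ⊔ p)
Enumeration {A = A} P n = Σ (Fin n → A) λ e →
  (∀ i → P (e i)) × (∀ i j → e i ≡ e j → i ≡ j) × (∀ x → P x → ∃[ i ] e i ≡ x)

enumerate : ∀ n {P : Pred (Fin n) p} → Decidable P → ∃[ m ] Enumeration P m
enumerate zero    P? = 0 , (λ ()) , (λ ()) , (λ ()) , λ ()
enumerate (suc n) {P = P} P? with enumerate n (λ x → P? (suc x)) | P? zero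
... | m , e , e∈ , e-inj , e-surj | no ¬P0 =
  m , suc ∘′ e , e∈ , (λ i j eq → e-inj i j (suc-injective eq)) , surj
  where
  surj : ∀ x → P x → ∃[ i ] suc (e i) ≡ x
  surj zero    P0 = contradiction P0 ¬P0
  surj (suc x) Px = map₂ (cong suc) (e-surj x Px)
... | m , e , e∈ , e-inj , e-surj | yes P0 = suc m , e′ , e′∈ , e′-inj , e′-surj
  where
  e′ : Fin (suc m) → Fin (suc n)
  e′ zero    = zero
  e′ (suc i) = suc (e i)
  e′∈ : ∀ i → P (e′ i)
  e′∈ zero    = P0
  e′∈ (suc i) = e∈ i
  e′-inj : ∀ i j → e′ i ≡ e′ j → i ≡ j
  e′-inj zero    zero    _  = refl
  e′-inj (suc i) (suc j) eq = cong suc (e-inj i j (suc-injective eq))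
  e′-surj : ∀ x → P x → ∃[ i ] e′ i ≡ x
  e′-surj zero    _  = zero , refl
  e′-surj (suc x) Px = map suc (cong suc) (e-surj x Px)

Enumeration-restrict : {A : Set a} {P : Pred A p} {Q : Pred A q} →
                       Enumeration P n → (∀ {x} → Q x → P x) → (∀ x → P x → Dec (Q x)) →
                       ∃[ m ] Enumeration Q m
Enumeration-restrict {Q = Q} (e , e∈ , e-inj , e-surj) Q⇒P Q?
  with enumerate _ (λ i → Q? (e i) (e∈ i))
... | m , d , d∈ , d-inj , d-surj =
  m , e ∘′ d , d∈ , (λ i j eq → d-inj i j (e-inj (d i) (d j) eq)) , surj
  where
  surj : ∀ x → Q x → ∃[ i ] e (d i) ≡ x
  surj x Qx with e-surj x (Q⇒P Qx)
  ... | i , refl = map₂ (cong e) (d-surj i Qx)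

Fibre : (c : Fin N → Fin n) → Fin n → Set
Fibre {N = N} c v = Σ (Fin N) λ x → c x ≡ v

preimage : (c : Fin N → Fin n) → Fin N → Fin n → Fin N
preimage c default v with any? (λ x → c x ≟ v)
... | yes (x , _) = x
... | no  _       = default

preimage-correct : ∀ (c : Fin N → Fin n) default {v} x → c x ≡ v → c (preimage c default v) ≡ v
preimage-correct c default {v} x cx≡v with any? (λ y → c y ≟ v)
... | yes (_ , cy≡v) = cy≡v
... | no  ∄y         = contradiction (x , cx≡v) ∄y

≤-*-fibres : (c : Fin N → Fin n) → (∀ x → Fibre c (c x) ↣ Fin m) → N ≤ n * m
≤-*-fibres {zero}  c φ = z≤n
≤-*-fibres {suc N} c φ = injective⇒≤ index-injective
  where
  position : ∀ v x → c x ≡ v → Fin _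
  position v x cx≡v = to (φ (preimage c zero v))
    (x , trans cx≡v (sym (preimage-correct c zero x cx≡v)))
  position-injective : ∀ {v w x y} (cx≡v : c x ≡ v) (cy≡w : c y ≡ w) → v ≡ w →
                       position v x cx≡v ≡ position w y cy≡w → x ≡ y
  position-injective _ _ refl eq = cong proj₁ (injective (φ _) eq)
  index : Fin (suc N) → Fin _
  index x = combine (c x) (position (c x) x refl)
  index-injective : Injective _≡_ _≡_ index
  index-injective {x} {y} eq with combine-injective (c x) _ (c y) _ eq
  ... | cx≡cy , eq′ = position-injective refl refl cx≡cy eq′

module CategoryProperties {o ℓ : Level} (C : Category o ℓ) where
  open Category C
  open CatDefs C
  open ≡-Reasoning

  retraction-cancelʳ : ∀ {P Q R} {x x′ : Hom Q R} {y : Hom P Q} (z : Hom Q P) →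
                       y ∘ z ≡ id → x ∘ y ≡ x′ ∘ y → x ≡ x′
  retraction-cancelʳ {x = x} {x′} {y} z yz≡id xy≡x′y = begin
    x            ≡⟨ sym (identityʳ x) ⟩
    x ∘ id       ≡⟨ cong (x ∘_) (sym yz≡id) ⟩
    x ∘ (y ∘ z)  ≡⟨ sym (assoc x y z) ⟩
    (x ∘ y) ∘ z  ≡⟨ cong (_∘ z) xy≡x′y ⟩
    (x′ ∘ y) ∘ z ≡⟨ assoc x′ y z ⟩
    x′ ∘ (y ∘ z) ≡⟨ cong (x′ ∘_) yz≡id ⟩
    x′ ∘ id      ≡⟨ identityʳ x′ ⟩
    x′           ∎

  section-cancelˡ : ∀ {P Q R} {x x′ : Hom P Q} {y : Hom Q R} (z : Hom R Q) →
                    z ∘ y ≡ id → y ∘ x ≡ y ∘ x′ → x ≡ x′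
  section-cancelˡ {x = x} {x′} {y} z zy≡id yx≡yx′ = begin
    x            ≡⟨ sym (identityˡ x) ⟩
    id ∘ x       ≡⟨ cong (_∘ x) (sym zy≡id) ⟩
    (z ∘ y) ∘ x  ≡⟨ assoc z y x ⟩
    z ∘ (y ∘ x)  ≡⟨ cong (z ∘_) yx≡yx′ ⟩
    z ∘ (y ∘ x′) ≡⟨ sym (assoc z y x′) ⟩
    (z ∘ y) ∘ x′ ≡⟨ cong (_∘ x′) zy≡id ⟩
    id ∘ x′      ≡⟨ identityˡ x′ ⟩
    x′           ∎

  IsIso-∘ : ∀ {P Q R} {x : Hom Q R} {y : Hom P Q} → IsIso x → IsIso y → IsIso (x ∘ y)
  IsIso-∘ {x = x} {y} (x⁻¹ , x⁻¹x≡id , xx⁻¹≡id) (y⁻¹ , y⁻¹y≡id , yy⁻¹≡id) =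
    y⁻¹ ∘ x⁻¹ , cancel x⁻¹ y⁻¹ y x x⁻¹x≡id y⁻¹y≡id , cancel y x x⁻¹ y⁻¹ yy⁻¹≡id xx⁻¹≡id
    where
    cancel : ∀ {Q R S} (a : Hom Q R) (b : Hom R S) (c : Hom S R) (d : Hom R Q) →
             a ∘ d ≡ id → b ∘ c ≡ id → (b ∘ a) ∘ (d ∘ c) ≡ id
    cancel a b c d ad≡id bc≡id = begin
      (b ∘ a) ∘ (d ∘ c) ≡⟨ assoc b a (d ∘ c) ⟩
      b ∘ (a ∘ (d ∘ c)) ≡⟨ cong (b ∘_) (sym (assoc a d c)) ⟩
      b ∘ ((a ∘ d) ∘ c) ≡⟨ cong (λ t → b ∘ (t ∘ c)) ad≡id ⟩
      b ∘ (id ∘ c)      ≡⟨ cong (b ∘_) (identityˡ c) ⟩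
      b ∘ c             ≡⟨ bc≡id ⟩
      id                ∎

  IsIso-inverse : ∀ {P Q} {x : Hom P Q} (x-iso : IsIso x) → IsIso (proj₁ x-iso)
  IsIso-inverse {x = x} (_ , x⁻¹x≡id , xx⁻¹≡id) = x , xx⁻¹≡id , x⁻¹x≡id

  left-inverse⇒right-inverse : ∀ {P Q} {t : Hom P Q} {r : Hom Q P} →
                               IsIso t → r ∘ t ≡ id → t ∘ r ≡ id
  left-inverse⇒right-inverse {t = t} {r} (t⁻¹ , t⁻¹t≡id , tt⁻¹≡id) rt≡id = begin
    t ∘ r   ≡⟨ cong (t ∘_) (retraction-cancelʳ t⁻¹ tt⁻¹≡id (trans rt≡id (sym t⁻¹t≡id))) ⟩
    t ∘ t⁻¹ ≡⟨ tt⁻¹≡id ⟩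
    id      ∎

module SettingProperties {o ℓ : Level} (S : Setting o ℓ) where
  open Setting S
  open SettingDefs S
  open CategoryProperties cat
  open ≡-Reasoning

  right-inverse-unique : ∀ {V Y} → inD V → inD Y → {r : Hom V Y} {t t′ : Hom Y V} →
                         r ∘ t ≡ id → r ∘ t′ ≡ id → t ≡ t′
  right-inverse-unique Vd Yd {r} {t} {t′} rt≡id rt′≡id =
    section-cancelˡ t tr≡id (trans rt≡id (sym rt′≡id))
    where
    tr≡id : t ∘ r ≡ id
    tr≡id = left-inverse⇒right-inverse
      (G2-III Yd Vd t (λ _ u v tu≡tv → section-cancelˡ r rt≡id tu≡tv)) rt≡id

  Section : ∀ {U Y} → Hom U Y → Set ℓ
  Section {U} {Y} q = Σ (Hom Y U) λ s → q ∘ s ≡ id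

  sections-through-component-unique :
    ∀ {U Y} → inD Y → (q : Hom U Y) (i : Ix U) {s s′ : Hom Y U} {t t′ : Hom Y (idom i)} →
    q ∘ s ≡ id → q ∘ s′ ≡ id → s ≡ ι i ∘ t → s′ ≡ ι i ∘ t′ → s ≡ s′
  sections-through-component-unique Yd q i {s} {s′} {t} {t′} qs≡id qs′≡id s≡ιt s′≡ιt′ = begin
    s        ≡⟨ s≡ιt ⟩
    ι i ∘ t  ≡⟨ cong (ι i ∘_) t≡t′ ⟩
    ι i ∘ t′ ≡⟨ sym s′≡ιt′ ⟩
    s′       ∎
    where
    through : ∀ {s₀ t₀} → s₀ ≡ ι i ∘ t₀ → q ∘ s₀ ≡ id → (q ∘ ι i) ∘ t₀ ≡ id
    through {s₀} {t₀} s₀≡ιt₀ qs₀≡id =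
      trans (assoc q (ι i) t₀) (trans (cong (q ∘_) (sym s₀≡ιt₀)) qs₀≡id)
    t≡t′ : t ≡ t′
    t≡t′ = right-inverse-unique (idomD i) Yd (through s≡ιt qs≡id) (through s′≡ιt′ qs′≡id)

  -- A section of q is determined by the member of Σ(U) it factors through, and
  -- (G4)(II) bounds the number of members of Σ(U) by deg q.
  sections↣deg : ∀ {U Y} → inD Y → (q : Hom U Y) → Section q ↣ Fin (deg q)
  sections↣deg {U} Yd q with G4-II Yd q
  ... | n , e , _ , e-surj , deg≡sum = ↣-inject≤ n≤deg ↣-∘ mk↣ index-injective
    where
    n≤deg : n ≤ deg q
    n≤deg = ≤-trans (n≤sumFin n _ (λ i → deg-pos Yd (q ∘ ι (e i)))) (≤-reflexive (sym deg≡sum))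
    component : Section q → Ix U
    component (s , _) = proj₁ (G3-ex Yd s)
    index : Section q → Fin n
    index s = proj₁ (e-surj (component s))
    component-injective : Injective _≡_ _≡_ component
    component-injective {s , qs≡id} {s′ , qs′≡id} eq with G3-ex Yd s | G3-ex Yd s′
    ... | i , t , s≡ιt | _ , t′ , s′≡ιt′ with refl ← eq =
      proj₁-injective uip (sections-through-component-unique Yd q i qs≡id qs′≡id s≡ιt s′≡ιt′)
    index-injective : Injective _≡_ _≡_ index
    index-injective {s} {s′} eq = component-injective (begin
      component s  ≡⟨ sym (proj₂ (e-surj (component s))) ⟩
      e (index s)  ≡⟨ cong e eq ⟩
      e (index s′) ≡⟨ proj₂ (e-surj (component s′)) ⟩
      component s′ ∎)

  -- Each k ∈ Hom(u, f) yields the section ⟨k, id⟩ of the pullback of f along u,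
  -- whose degree is deg f by (G4)(III).
  homOver↣deg : ∀ {A X Y} → inD A → inD X → inD Y → (f : Hom A X) (u : Hom Y X) →
                HomOver u f ↣ Fin (deg f)
  homOver↣deg {Y = Y} Ad Xd Yd f u with G1 Xd Ad Yd f u
  ... | U , p , q , pb@(_ , universal) =
    subst (λ d → Section q ↣ Fin d) (sym deg-f≡deg-q) (sections↣deg Yd q) ↣-∘ mk↣ lift-injective
    where
    deg-f≡deg-q : deg f ≡ deg q
    deg-f≡deg-q = proj₁ (G4-III Xd Ad Yd f u p q pb)
    mediator : (k : HomOver u f) → Σ (Hom Y U) λ s → (p ∘ s ≡ proj₁ k) × (q ∘ s ≡ id)
    mediator (k , u≡fk) = proj₁ (universal k id (trans (sym u≡fk) (sym (identityʳ u))))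
    lift : HomOver u f → Section q
    lift k = proj₁ (mediator k) , proj₂ (proj₂ (mediator k))
    lift-injective : Injective _≡_ _≡_ lift
    lift-injective {k} {k′} eq = proj₁-injective uip (begin
      proj₁ k             ≡⟨ sym (proj₁ (proj₂ (mediator k))) ⟩
      p ∘ proj₁ (lift k)  ≡⟨ cong (λ s → p ∘ proj₁ s) eq ⟩
      p ∘ proj₁ (lift k′) ≡⟨ proj₁ (proj₂ (mediator k′)) ⟩
      proj₁ k′            ∎)

  AutCard⇒≤deg : ∀ {A B} → inD A → inD B → (h : Hom B A) → AutCard h m → m ≤ deg h
  AutCard⇒≤deg Ad Bd h (e , e-aut , e-inj , _) =
    ↣⇒≤ (homOver↣deg Bd Ad Bd h h ↣-∘ mk↣ {to = endo} λ {i} {j} eq → e-inj i j (cong proj₁ eq))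
    where
    endo : Fin _ → HomOver h h
    endo i = e i , proj₁ (e-aut i)

  IsAut-∘ˡ : ∀ {A B X} (f : Hom A X) {h : Hom B A} {σ} → IsAut h σ → IsAut (f ∘ h) σ
  IsAut-∘ˡ f {h} {σ} (h≡hσ , σ-iso) =
    trans (cong (f ∘_) h≡hσ) (sym (assoc f h σ)) , σ-iso

  IsAut-∘-inverse : ∀ {A B} {h : Hom B A} {σ τ : Hom B B} (σ-iso : IsIso σ) → IsIso τ →
                    h ∘ τ ≡ h ∘ σ → IsAut h (τ ∘ proj₁ σ-iso)
  IsAut-∘-inverse {h = h} {σ} {τ} σ-iso@(σ⁻¹ , _ , σσ⁻¹≡id) τ-iso hτ≡hσ =
    sym h∘τσ⁻¹≡h , IsIso-∘ τ-iso (IsIso-inverse σ-iso)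
    where
    h∘τσ⁻¹≡h : h ∘ (τ ∘ σ⁻¹) ≡ h
    h∘τσ⁻¹≡h = begin
      h ∘ (τ ∘ σ⁻¹) ≡⟨ sym (assoc h τ σ⁻¹) ⟩
      (h ∘ τ) ∘ σ⁻¹ ≡⟨ cong (_∘ σ⁻¹) hτ≡hσ ⟩
      (h ∘ σ) ∘ σ⁻¹ ≡⟨ assoc h σ σ⁻¹ ⟩
      h ∘ (σ ∘ σ⁻¹) ≡⟨ cong (h ∘_) σσ⁻¹≡id ⟩
      h ∘ id        ≡⟨ identityʳ h ⟩
      h             ∎

  module Factorisation {A B X} (Ad : inD A) (Bd : inD B) (Xd : inD X)
                       (f : Hom A X) (h : Hom B A) where

    homOver↣ : HomOver (f ∘ h) f ↣ Fin (deg f)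
    homOver↣ = homOver↣deg Ad Xd Bd f (f ∘ h)

    h∘aut : ∀ {σ} → IsAut (f ∘ h) σ → HomOver (f ∘ h) f
    h∘aut {σ} (fh≡fhσ , _) = h ∘ σ , trans fh≡fhσ (assoc f h σ)

    IsAut? : ∀ σ → IsAut (f ∘ h) σ → Dec (IsAut h σ)
    IsAut? σ σ-aut@(_ , σ-iso) =
      map′ (λ eq → sym (cong proj₁ (injective homOver↣ eq)) , σ-iso)
           (λ (h≡hσ , _) → cong (to homOver↣) (proj₁-injective uip (sym h≡hσ)))
           (to homOver↣ (h∘aut σ-aut) ≟ to homOver↣ (h , refl))

    AutCard-restrict : AutCard (f ∘ h) N → ∃[ m ] AutCard h m
    AutCard-restrict aut = Enumeration-restrict aut (IsAut-∘ˡ f) IsAut?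

    -- The fibres of σ ↦ h ∘ σ are the cosets Aut(h) σ.
    AutCard-∘ : AutCard (f ∘ h) N → AutCard h m → N ≤ deg f * m
    AutCard-∘ (e , e-aut , e-inj , _) (e′ , _ , _ , e′-surj) = ≤-*-fibres c coset↣
      where
      c : Fin _ → Fin (deg f)
      c x = to homOver↣ (h∘aut (e-aut x))
      coset↣ : ∀ x → Fibre c (c x) ↣ Fin _
      coset↣ x = mk↣ coset-injective
        where
        σ⁻¹ : Hom B B
        σ⁻¹ = proj₁ (proj₂ (e-aut x))
        σ⁻¹σ≡id : σ⁻¹ ∘ e x ≡ id
        σ⁻¹σ≡id = proj₁ (proj₂ (proj₂ (e-aut x)))
        quotient-aut : (y : Fibre c (c x)) → IsAut h (e (proj₁ y) ∘ σ⁻¹)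
        quotient-aut (y , cy≡cx) =
          IsAut-∘-inverse (proj₂ (e-aut x)) (proj₂ (e-aut y))
                          (cong proj₁ (injective homOver↣ cy≡cx))
        coset : Fibre c (c x) → Fin _
        coset y = proj₁ (e′-surj _ (quotient-aut y))
        coset-injective : Injective _≡_ _≡_ coset
        coset-injective {y , cy≡cx} {y′ , cy′≡cx} eq =
          proj₁-injective uip (e-inj y y′ (retraction-cancelʳ (e x) σ⁻¹σ≡id (begin
            e y ∘ σ⁻¹                ≡⟨ sym (proj₂ (e′-surj _ (quotient-aut (y , cy≡cx)))) ⟩
            e′ (coset (y , cy≡cx))   ≡⟨ cong e′ eq ⟩
            e′ (coset (y′ , cy′≡cx)) ≡⟨ proj₂ (e′-surj _ (quotient-aut (y′ , cy′≡cx))) ⟩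
            e y′ ∘ σ⁻¹               ∎)))

corollary3p15 : ∀ {o ℓ : Level} (S : Setting o ℓ) → Cor3p15 S
corollary3p15 S f _ (Ad , Xd) (Bd , _) _ aut-g h refl _ =
  subst (AutCard h) (≤-antisym (AutCard⇒≤deg Ad Bd h aut-h) deg-h≤∣Aut-h∣) aut-h
  where
  open Setting S
  open SettingDefs S
  open SettingProperties S
  open Factorisation Ad Bd Xd f h
  ∣Aut-h∣ : ℕ
  ∣Aut-h∣ = proj₁ (AutCard-restrict aut-g)
  aut-h : AutCard h ∣Aut-h∣
  aut-h = proj₂ (AutCard-restrict aut-g)
  deg-h≤∣Aut-h∣ : deg h ≤ ∣Aut-h∣
  deg-h≤∣Aut-h∣ = *-cancelˡ-≤ (deg f) {{>-nonZero (deg-pos Xd f)}}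
    (≤-trans (≤-reflexive (sym (G4-I Ad Xd h f))) (AutCard-∘ aut-g aut-h))
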